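{- Let $T$ be a tournament with $|V(T)|\ge 4$. Then $T$ is $BK$-colorable if and only if $T$ is strongly connected.
   Context: A tournament is an orientation of a complete graph. A digraph $D$ is $BK$-colorable if there exists $c:A(D)\to\{1,2\}$ such that $(D,c)$ has a bikernel, where a non-empty $B\subseteq V(D)$ is a bikernel (by monochromatic paths) if: (i) for all distinct $u,v\in B$ there is no monochromatic directed $uv$-path; (ii) for every $v\in V(D)\setminus B$ there is a directed path of color $1$ from $v$ to a vertex of $B$; (iii) for every $v\in V(D)\setminus B$ there is a directed path of color $2$ from a vertex of $B$ to $v$. -}

module Defs where

open import Data.Nat using (ℕ)
open import Data.Fin using (Fin)
open import Data.List using (List; []; _∷_)
open import Data.List.Relation.Unary.Unique.Propositional using (Unique)
open import Data.Product using (Σ; ∃; ∃-syntax; _×_; _,_)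
open import Data.Sum using (_⊎_)
open import Data.Empty using (⊥)
open import Relation.Nullary using (¬_)
open import Relation.Binary.PropositionalEquality using (_≡_; _≢_)
open import Level using (0ℓ; suc)

record Tournament (n : ℕ) : Set₁ where
  field
    Arc        : Fin n → Fin n → Set
    irrefl     : ∀ u → ¬ Arc u u
    total      : ∀ u v → u ≢ v → Arc u v ⊎ Arc v u
    asym       : ∀ u v → Arc u v → ¬ Arc v u
    arc-unique : ∀ u v (a b : Arc u v) → a ≡ b

open Tournament public

-- An arc colouring with two colours (Fin 2 : colour 1 = zero, colour 2 = suc zero).
Coloring : ∀ {n} → Tournament n → Set
Coloring T = ∀ u v → Arc T u v → Fin 2

data Walk {n} (T : Tournament n) : Fin n → Fin n → Set where
  [] : ∀ {u} → Walk T u u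
  _∷_ : ∀ {u w v} → Arc T u w → Walk T w v → Walk T u v

vertices : ∀ {n} {T : Tournament n} {u v} → Walk T u v → List (Fin n)
vertices {u = u} [] = u ∷ []
vertices {u = u} (a ∷ p) = u ∷ vertices p

Mono : ∀ {n} {T : Tournament n} → Coloring T → Fin 2 → ∀ {u v} → Walk T u v → Set
Mono c i [] = Data.Unit.⊤ where import Data.Unit
Mono c i (_∷_ {u} {w} a p) = (c u w a ≡ i) × Mono c i p

Path : ∀ {n} → Tournament n → Fin n → Fin n → Set
Path T u v = Σ (Walk T u v) λ p → Unique (vertices p)

MonoPath : ∀ {n} (T : Tournament n) → Coloring T → Fin 2 → Fin n → Fin n → Set
MonoPath T c i u v = Σ (Path T u v) λ p → Mono c i (Data.Product.proj₁ p)

Subset : ℕ → Set₁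
Subset n = Fin n → Set

colour1 colour2 : Fin 2
colour1 = Fin.zero where import Data.Fin as Fin
colour2 = Fin.suc Fin.zero where import Data.Fin as Fin

IsBikernel : ∀ {n} (T : Tournament n) → Coloring T → Subset n → Set
IsBikernel {n} T c B =
  (∃[ x ] B x)
  × (∀ u v → B u → B v → u ≢ v → ∀ i → ¬ MonoPath T c i u v)
  × (∀ v → ¬ B v → ∃[ b ] (B b × MonoPath T c colour1 v b))
  × (∀ v → ¬ B v → ∃[ b ] (B b × MonoPath T c colour2 b v))

BKColorable : ∀ {n} → Tournament n → Set₁
BKColorable {n} T = ∃[ c ] ∃[ B ] IsBikernel {n} T c B

StronglyConnected : ∀ {n} → Tournament n → Set
StronglyConnected {n} T = ∀ (u v : Fin n) → Path T u v

{-# OPTIONS --safe #-}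
module Submission where

-- In a tournament any two vertices are joined by an arc, which is a monochromatic path, so a
-- bikernel is a single vertex r; every vertex then reaches r and is reached from r.
-- Conversely it suffices to find a root r and a colouring with colour-1 paths from every vertex
-- to r and colour-2 paths from r to every vertex. Colour 1 the arcs into r, the arcs inside the
-- out-neighbourhood O of r and one arc o₁ → i₁ from O to the in-neighbourhood I, where o₁ is
-- reached from all of O inside O; colour 2 the rest. This works once a second arc o₂ → i₂ from
-- O to I has a head i₂ reaching all of I inside I. Starting from a king r such an arc exists
-- unless o₁ is the only in-neighbour of i₁; then i₁ is a king that can only fail in the same
-- way, with r the only in-neighbour of o₁, and after three such rotations the triangle r o₁ i₁
-- receives no arc from outside, contradicting strong connectivity once there is a fourth vertex.

open import Defs
open import Data.Nat using (ℕ; _≥_; _<_; s≤s; z≤n)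
open import Data.Nat.Properties using (≤-trans; <⇒≱)
open import Data.Fin using (Fin; zero; suc; fromℕ<)
open import Data.Fin.Properties using (_≟_; any?; injective⇒≤)
open import Data.List using (List; []; _∷_; allFin)
open import Data.List.Relation.Unary.Any using (here; there)
open import Data.List.Relation.Unary.All as All using (All; []; _∷_)
open import Data.List.Relation.Unary.All.Properties.Core using (¬Any⇒All¬)
open import Data.List.Relation.Unary.AllPairs using ([]; _∷_)
open import Data.List.Relation.Unary.Unique.Propositional using (Unique)
open import Data.List.Membership.Propositional using (_∈_)
open import Data.List.Membership.Propositional.Properties using (∈-allFin)
import Data.List.Membership.DecPropositional as DecMembership
open import Data.Product using (Σ; ∃; ∃₂; ∃-syntax; _×_; _,_; proj₁; proj₂)
open import Data.Sum using (_⊎_; inj₁; inj₂; swap)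
open import Data.Bool using (if_then_else_)
open import Data.Empty using (⊥-elim)
open import Data.Unit using (tt)
open import Function using (_∘_; id; flip)
open import Function.Bundles using (_⇔_; mk⇔)
open import Function.Definitions using (Injective)
open import Level using (0ℓ)
open import Relation.Nullary using (¬_; Dec; yes; no; does; contradiction)
open import Relation.Nullary.Decidable using (_×-dec_; _⊎-dec_; ¬?; dec-true; dec-false; decidable-stable)
open import Relation.Unary using (Pred; Decidable)
open import Relation.Binary using (Rel; _⇒_)
open import Relation.Binary.PropositionalEquality using (_≡_; _≢_; refl; sym; trans; cong; subst)
open import Relation.Binary.Construct.Closure.ReflexiveTransitive
  using (Star; ε; _◅_; _◅◅_; return; reverse) renaming (map to mapStar)

private
  variable
    n : ℕ
    u v w x y r : Fin n

ColouredArc : (T : Tournament n) → Coloring T → Fin 2 → Rel (Fin n) 0ℓ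
ColouredArc T c i u v = Σ (Arc T u v) λ a → c u v a ≡ i

module _ {n : ℕ} {T : Tournament n} where

  open DecMembership (_≟_ {n = n}) using (_∈?_)

  fromWalk : Walk T u v → Star (Arc T) u v
  fromWalk [] = ε
  fromWalk (a ∷ p) = a ◅ fromWalk p

  module _ {E : Rel (Fin n) 0ℓ} (arc : E ⇒ Arc T) where

    toWalk : Star E u v → Walk T u v
    toWalk ε = []
    toWalk (e ◅ p) = arc e ∷ toWalk p

    IsSimple : Star E u v → Set
    IsSimple p = Unique (vertices (toWalk p))

    dropUntil : (p : Star E w v) → u ∈ vertices (toWalk p) → IsSimple p → Σ (Star E u v) IsSimple
    dropUntil ε (here refl) simple = ε , simple
    dropUntil (e ◅ p) (here refl) simple = e ◅ p , simple
    dropUntil (e ◅ p) (there u∈p) (_ ∷ simple) = dropUntil p u∈p simple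

    loopErase : Star E u v → Σ (Star E u v) IsSimple
    loopErase ε = ε , [] ∷ []
    loopErase {u = u} (e ◅ p) with loopErase p
    ... | q , simple with u ∈? vertices (toWalk q)
    ... | yes u∈q = dropUntil q u∈q simple
    ... | no u∉q = e ◅ q , ¬Any⇒All¬ _ u∉q ∷ simple

    toPath : Star E u v → Path T u v
    toPath p = let q , simple = loopErase p in toWalk q , simple

  monoPath⇒star : ∀ {c i} → MonoPath T c i u v → Star (Arc T) u v
  monoPath⇒star ((walk , _) , _) = fromWalk walk

  toMonoPath : ∀ {c i} → Star (ColouredArc T c i) u v → MonoPath T c i u v
  toMonoPath {c = c} {i} p = let q , simple = loopErase proj₁ p in (toWalk proj₁ q , simple) , mono q
    where
    mono : (q : Star (ColouredArc T c i) x y) → Mono c i (toWalk proj₁ q)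
    mono ε = tt
    mono ((_ , colour) ◅ q) = colour , mono q

Induced : ∀ {A : Set} → Rel A 0ℓ → Pred A 0ℓ → Rel A 0ℓ
Induced R P u v = R u v × P u × P v

exitArc : ∀ {A : Set} {R : Rel A 0ℓ} {P : Pred A 0ℓ} {x y : A} → Decidable P → Star R x y → P x → ¬ P y →
          ∃₂ λ u w → Star (Induced R P) x u × R u w × P u × ¬ P w
exitArc P? ε px ¬py = contradiction px ¬py
exitArc P? (_◅_ {j = w} a p) px ¬py with P? w
... | no ¬pw = _ , w , ε , a , px , ¬pw
... | yes pw = let u , w′ , q , b , pu , ¬pw′ = exitArc P? p pw ¬py
               in u , w′ , (a , px , pw) ◅ q , b , pu , ¬pw′

OneOf : Fin n → Fin n → Fin n → Pred (Fin n) 0ℓ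
OneOf a b c x = x ≡ a ⊎ x ≡ b ⊎ x ≡ c

oneOf? : (a b c : Fin n) → Decidable (OneOf a b c)
oneOf? a b c x = (x ≟ a) ⊎-dec (x ≟ b) ⊎-dec (x ≟ c)

∃-outside : 3 < n → (a b c : Fin n) → ∃[ x ] ¬ OneOf a b c x
∃-outside {n} n>3 a b c with any? (¬? ∘ oneOf? a b c)
... | yes outside = outside
... | no none = contradiction (injective⇒≤ index-injective) (<⇒≱ n>3)
  where
  pick : Fin 3 → Fin n
  pick zero = a
  pick (suc zero) = b
  pick (suc (suc zero)) = c

  covered : ∀ x → ∃[ i ] pick i ≡ x
  covered x with oneOf? a b c x
  ... | yes (inj₁ x≡a) = zero , sym x≡a
  ... | yes (inj₂ (inj₁ x≡b)) = suc zero , sym x≡b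
  ... | yes (inj₂ (inj₂ x≡c)) = suc (suc zero) , sym x≡c
  ... | no ¬one = ⊥-elim (none (x , ¬one))

  index-injective : Injective _≡_ _≡_ (proj₁ ∘ covered)
  index-injective {x} {y} eq = trans (sym (proj₂ (covered x))) (trans (cong pick eq) (proj₂ (covered y)))

opposite : Tournament n → Tournament n
opposite T = record
  { Arc = flip (Arc T)
  ; irrefl = irrefl T
  ; total = λ u v u≢v → swap (total T u v u≢v)
  ; asym = λ u v → asym T v u
  ; arc-unique = λ u v → arc-unique T v u
  }

module TournamentProperties (T : Tournament n) where

  arc⇒≢ : Arc T u v → u ≢ v
  arc⇒≢ {u = u} a refl = irrefl T u a

  ¬arc⇒arc : u ≢ v → ¬ Arc T v u → Arc T u v
  ¬arc⇒arc {u = u} {v} u≢v ¬vu with total T u v u≢v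
  ... | inj₁ uv = uv
  ... | inj₂ vu = contradiction vu ¬vu

  trichotomy : ∀ u v → u ≡ v ⊎ Arc T u v ⊎ Arc T v u
  trichotomy u v with u ≟ v
  ... | yes u≡v = inj₁ u≡v
  ... | no u≢v = inj₂ (total T u v u≢v)

  arc? : ∀ u v → Dec (Arc T u v)
  arc? u v with trichotomy u v
  ... | inj₁ refl = no (irrefl T u)
  ... | inj₂ (inj₁ uv) = yes uv
  ... | inj₂ (inj₂ vu) = no (asym T v u vu)

  ReachedFromAll ReachesAll : Pred (Fin n) 0ℓ → Pred (Fin n) 0ℓ
  ReachedFromAll P k = ∀ y → P y → Star (Induced (Arc T) P) y k
  ReachesAll P k = ∀ y → P y → Star (Induced (Arc T) P) k y

  ∃-reachedFromAll : ∀ {P} → Decidable P → P x → ∃[ k ] P k × ReachedFromAll P k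
  ∃-reachedFromAll {x = x₀} {P} P? px₀ =
    let k , pk , reach = candidate (allFin n) in k , pk , λ y → All.lookup reach (∈-allFin y)
    where
    candidate : (L : List (Fin n)) → ∃[ k ] P k × All (λ y → P y → Star (Induced (Arc T) P) y k) L
    candidate [] = x₀ , px₀ , []
    candidate (x ∷ L) with candidate L
    ... | k , pk , reach with P? x
    ... | no ¬px = k , pk , (λ px → contradiction px ¬px) ∷ reach
    ... | yes px with trichotomy x k
    ... | inj₁ refl = k , pk , (λ _ → ε) ∷ reach
    ... | inj₂ (inj₁ xk) = k , pk , (λ _ → return (xk , px , pk)) ∷ reach
    ... | inj₂ (inj₂ kx) = x , px , (λ _ → ε) ∷ All.map (λ y⇝k py → y⇝k py ◅◅ return (kx , pk , px)) reach

  King : Pred (Fin n) 0ℓ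
  King r = ∀ y → Arc T y r → ∃[ o ] Arc T r o × Arc T o y

  ∃-king : Fin n → ∃ King
  ∃-king x₀ = let k , near = candidate (allFin n) in k , λ y yk → twoStep (All.lookup near (∈-allFin y)) yk
    where
    WithinTwo : Rel (Fin n) 0ℓ
    WithinTwo k y = y ≡ k ⊎ Arc T k y ⊎ ∃[ o ] Arc T k o × Arc T o y

    withinTwo? : ∀ k y → Dec (WithinTwo k y)
    withinTwo? k y = (y ≟ k) ⊎-dec arc? k y ⊎-dec any? (λ o → arc? k o ×-dec arc? o y)

    twoStep : ∀ {k y} → WithinTwo k y → Arc T y k → ∃[ o ] Arc T k o × Arc T o y
    twoStep (inj₁ refl) yk = contradiction yk (irrefl T _)
    twoStep (inj₂ (inj₁ ky)) yk = contradiction ky (asym T _ _ yk)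
    twoStep (inj₂ (inj₂ path)) _ = path

    beatsOut : ∀ {k x z} → ¬ WithinTwo k x → Arc T k z → Arc T x z
    beatsOut far kz = ¬arc⇒arc (λ { refl → far (inj₂ (inj₁ kz)) }) (λ zx → far (inj₂ (inj₂ (_ , kz , zx))))

    overtake : ∀ {k x} → ¬ WithinTwo k x → WithinTwo k y → WithinTwo x y
    overtake far (inj₁ refl) = inj₂ (inj₁ (¬arc⇒arc (far ∘ inj₁) (far ∘ inj₂ ∘ inj₁)))
    overtake far (inj₂ (inj₁ ky)) = inj₂ (inj₁ (beatsOut far ky))
    overtake far (inj₂ (inj₂ (o , ko , oy))) = inj₂ (inj₂ (o , beatsOut far ko , oy))

    candidate : (L : List (Fin n)) → ∃[ k ] All (WithinTwo k) L
    candidate [] = x₀ , []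
    candidate (x ∷ L) with candidate L
    ... | k , near with withinTwo? k x
    ... | yes kx = k , kx ∷ near
    ... | no far = x , inj₁ refl ∷ All.map (overtake far) near

module _ (T : Tournament n) where

  open TournamentProperties T

  ∃-reachesAll : ∀ {P} → Decidable P → P x → ∃[ k ] P k × ReachesAll P k
  ∃-reachesAll P? px =
    let k , pk , reached = TournamentProperties.∃-reachedFromAll (opposite T) P? px
    in k , pk , λ y py → reverse (λ (a , pu , pv) → a , pv , pu) (reached y py)

  ∃-outNeighbour : StronglyConnected T → u ≢ v → ∃ (Arc T u)
  ∃-outNeighbour {u = u} {v} sc u≢v with sc u v
  ... | [] , _ = contradiction refl u≢v
  ... | (a ∷ _) , _ = _ , a

  inClosed⇒full : StronglyConnected T → ∀ {P} → Decidable P → (∀ {u v} → Arc T u v → P v → P u) → P y → ∀ x → P x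
  inClosed⇒full {y = y} sc P? closed py x with P? x
  ... | yes px = px
  ... | no ¬px with exitArc (¬? ∘ P?) (fromWalk (proj₁ (sc x y))) ¬px (λ ¬py → ¬py py)
  ... | _ , _ , _ , uw , ¬pu , ¬¬pw = ⊥-elim (¬¬pw (¬pu ∘ closed uw))

  arcMonoPath : (c : Coloring T) (a : Arc T u v) → MonoPath T c (c u v a) u v
  arcMonoPath c a = toMonoPath ((a , refl) ◅ ε)

  bikernel-singleton : ∀ {c B} → IsBikernel T c B → B x → B y → x ≡ y
  bikernel-singleton {x = x} {y} {c} (_ , independent , _) bx by with trichotomy x y
  ... | inj₁ x≡y = x≡y
  ... | inj₂ (inj₁ xy) = contradiction (arcMonoPath c xy) (independent x y bx by (arc⇒≢ xy) _)
  ... | inj₂ (inj₂ yx) = contradiction (arcMonoPath c yx) (independent y x by bx (arc⇒≢ yx) _)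

  bkColorable⇒strong : BKColorable T → StronglyConnected T
  bkColorable⇒strong (c , B , bk@((x , bx) , _ , toB , fromB)) u v = toPath id (toX u ◅◅ fromX v)
    where
    outside : y ≢ x → ¬ B y
    outside y≢x by = y≢x (bikernel-singleton bk by bx)

    toX : ∀ y → Star (Arc T) y x
    toX y with y ≟ x
    ... | yes refl = ε
    ... | no y≢x = let b , bb , path = toB y (outside y≢x)
                   in subst (Star (Arc T) y) (bikernel-singleton bk bb bx) (monoPath⇒star path)

    fromX : ∀ y → Star (Arc T) x y
    fromX y with y ≟ x
    ... | yes refl = ε
    ... | no y≢x = let b , bb , path = fromB y (outside y≢x)
                   in subst (flip (Star (Arc T)) y) (bikernel-singleton bk bb bx) (monoPath⇒star path)

  Out In : Fin n → Pred (Fin n) 0ℓ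
  Out r = Arc T r
  In r v = Arc T v r

  Triangle : Fin n → Fin n → Fin n → Set
  Triangle a b c = Arc T a b × Arc T b c × Arc T c a

  record GoodRoot (r : Fin n) : Set where
    constructor goodRoot
    field
      {o₁ i₁ o₂ i₂} : Fin n
      exitTriangle : Triangle r o₁ i₁
      entryTriangle : Triangle r o₂ i₂
      o₁-reachedFromAll : ReachedFromAll (Out r) o₁
      i₂-reachesAll : ReachesAll (In r) i₂
      distinct : ¬ (o₂ ≡ o₁ × i₂ ≡ i₁)

  Blocked : Fin n → Fin n → Fin n → Set
  Blocked r o i = Triangle r o i × (∀ x → Arc T x i → x ≡ o)

  Bibranching : Coloring T → Fin n → Set
  Bibranching c r = (∀ v → Star (ColouredArc T c colour1) v r) × (∀ v → Star (ColouredArc T c colour2) r v)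

  bibranching⇒bkColorable : ∀ {c} → Bibranching c r → BKColorable T
  bibranching⇒bkColorable {r = r} {c} (toRoot , fromRoot) =
    c , (_≡ r) , (r , refl) , (λ { _ _ refl refl r≢r → contradiction refl r≢r })
      , (λ v _ → r , refl , toMonoPath (toRoot v)) , (λ v _ → r , refl , toMonoPath (fromRoot v))

  colouring : (C : Rel (Fin n) 0ℓ) → (∀ u v → Dec (C u v)) → Coloring T
  colouring C C? u v _ = if does (C? u v) then colour1 else colour2

  colouring-colour1 : ∀ {C} (C? : ∀ u v → Dec (C u v)) → Arc T u v → C u v → ColouredArc T (colouring C C?) colour1 u v
  colouring-colour1 {u = u} {v} C? a cuv rewrite dec-true (C? u v) cuv = a , refl

  colouring-colour2 : ∀ {C} (C? : ∀ u v → Dec (C u v)) → Arc T u v → ¬ C u v → ColouredArc T (colouring C C?) colour2 u v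
  colouring-colour2 {u = u} {v} C? a ¬cuv rewrite dec-false (C? u v) ¬cuv = a , refl

  goodRoot⇒bibranching : GoodRoot r → ∃[ c ] Bibranching c r
  goodRoot⇒bibranching {r} (goodRoot {o₁} {i₁} (r→o₁ , o₁→i₁ , i₁→r) (r→o₂ , o₂→i₂ , i₂→r) reached reaches distinct) =
    c , toRoot , fromRoot
    where
    C : Rel (Fin n) 0ℓ
    C u v = v ≡ r ⊎ (u ≡ o₁ × v ≡ i₁) ⊎ (Out r u × Out r v)

    C? : ∀ u v → Dec (C u v)
    C? u v = (v ≟ r) ⊎-dec ((u ≟ o₁) ×-dec (v ≟ i₁)) ⊎-dec (arc? r u ×-dec arc? r v)

    c : Coloring T
    c = colouring C C?

    first : Arc T u v → C u v → ColouredArc T c colour1 u v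
    first = colouring-colour1 C?

    second : Arc T u v → ¬ C u v → ColouredArc T c colour2 u v
    second = colouring-colour2 C?

    ¬C : v ≢ r → ¬ (u ≡ o₁ × v ≡ i₁) → ¬ (Out r u × Out r v) → ¬ C u v
    ¬C v≢r _ _ (inj₁ v≡r) = v≢r v≡r
    ¬C _ ¬exit _ (inj₂ (inj₁ exit)) = ¬exit exit
    ¬C _ _ ¬out (inj₂ (inj₂ out)) = ¬out out

    leaving : Arc T r v → ¬ C r v
    leaving rv = ¬C (arc⇒≢ rv ∘ sym) (arc⇒≢ r→o₁ ∘ proj₁) (irrefl T r ∘ proj₁)

    insideIn : In r u → In r v → ¬ C u v
    insideIn ur vr = ¬C (arc⇒≢ vr) (λ { (refl , _) → asym T _ r ur r→o₁ }) (asym T _ r ur ∘ proj₁)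

    toRoot : ∀ v → Star (ColouredArc T c colour1) v r
    toRoot v with trichotomy v r
    ... | inj₁ refl = ε
    ... | inj₂ (inj₁ vr) = return (first vr (inj₁ refl))
    ... | inj₂ (inj₂ rv) =
      mapStar (λ (a , ru , rw) → first a (inj₂ (inj₂ (ru , rw)))) (reached v rv)
      ◅◅ first o₁→i₁ (inj₂ (inj₁ (refl , refl)))
      ◅ first i₁→r (inj₁ refl) ◅ ε

    fromRoot : ∀ v → Star (ColouredArc T c colour2) r v
    fromRoot v with trichotomy v r
    ... | inj₁ refl = ε
    ... | inj₂ (inj₂ rv) = return (second rv (leaving rv))
    ... | inj₂ (inj₁ vr) =
      second r→o₂ (leaving r→o₂)
      ◅ second o₂→i₂ (¬C (arc⇒≢ i₂→r) distinct (asym T _ r i₂→r ∘ proj₂))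
      ◅ mapStar (λ (a , ur , wr) → second a (insideIn ur wr)) (reaches v vr)

  ∃-exitTriangle : StronglyConnected T → Arc T r x → ∃₂ λ o i → Triangle r o i × ReachedFromAll (Out r) o
  ∃-exitTriangle {r} sc rx with ∃-reachedFromAll (arc? r) rx
  ... | s , rs , reachS with exitArc (arc? r) (fromWalk (proj₁ (sc s r))) rs (irrefl T r)
  ... | o , i , s⇝o , oi , ro , ¬ri = o , i , (ro , oi , ¬arc⇒arc i≢r ¬ri) , λ y ry → reachS y ry ◅◅ s⇝o
    where
    i≢r : i ≢ r
    i≢r refl = asym T r o ro oi

  ∃-entryTriangleThrough : King r → Arc T y r → ReachesAll (In r) y → Arc T x y →
                           ∃₂ λ o i → Triangle r o i × ReachesAll (In r) i × (o ≡ x ⊎ i ≡ x)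
  ∃-entryTriangleThrough {r} {y} {x} king yr reaches xy with trichotomy x r
  ... | inj₁ refl = contradiction xy (asym T y x yr)
  ... | inj₂ (inj₂ rx) = x , y , (rx , xy , yr) , reaches , inj₁ refl
  ... | inj₂ (inj₁ xr) =
    let o , ro , ox = king x xr
    in o , x , (ro , ox , xr) , (λ z zr → (xy , xr , yr) ◅ reaches z zr) , inj₂ refl

  -- Being a king, r sends an arc o → s into the vertex s reaching all of In r; if that arc is
  -- o₁ → i₁ itself, any other in-neighbour of i₁ provides a second entry.
  goodRoot-or-blocked : ∀ {o i} → King r → Triangle r o i → ReachedFromAll (Out r) o → GoodRoot r ⊎ ∃₂ (Blocked r)
  goodRoot-or-blocked {r} {o₁} {i₁} king exit@(_ , _ , i₁r) reached with ∃-reachesAll (λ v → arc? v r) i₁r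
  ... | s , sr , reachesS with king s sr
  ... | o , ro , os with (o ≟ o₁) ×-dec (s ≟ i₁)
  ... | no distinct = inj₁ (goodRoot exit (ro , os , sr) reached reachesS distinct)
  ... | yes (refl , refl) with any? (λ x → arc? x s ×-dec ¬? (x ≟ o))
  ... | no none = inj₂ (o , s , exit , λ x xs → decidable-stable (x ≟ o) (λ x≢o → none (x , xs , x≢o)))
  ... | yes (x , xs , x≢o) with ∃-entryTriangleThrough king sr reachesS xs
  ... | _ , _ , entry , reaches , inj₁ refl = inj₁ (goodRoot exit entry reached reaches (x≢o ∘ proj₁))
  ... | _ , _ , entry , reaches , inj₂ refl = inj₁ (goodRoot exit entry reached reaches (arc⇒≢ xs ∘ proj₂))

  blocked⇒king : ∀ {o i} → Blocked r o i → King i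
  blocked⇒king ((ro , _ , ir) , onlyO) y yi with onlyO y yi
  ... | refl = _ , ir , ro

  rotateBlocked : ∀ {o i} → StronglyConnected T → Blocked r o i → GoodRoot i ⊎ Blocked i r o
  rotateBlocked sc blocked@((ro , oi , ir) , onlyO) with ∃-exitTriangle sc ir
  ... | _ , _ , exit , reached with goodRoot-or-blocked (blocked⇒king blocked) exit reached
  ... | inj₁ good = inj₁ good
  ... | inj₂ (_ , i′ , (_ , _ , i′i) , onlyO′) with onlyO i′ i′i
  ... | refl with onlyO′ _ ro
  ... | refl = inj₂ ((ir , ro , oi) , onlyO′)

  blockedCycle-inClosed : ∀ {o i} → Blocked r o i → Blocked i r o → Blocked o i r →
                          Arc T u v → OneOf r o i v → OneOf r o i u
  blockedCycle-inClosed _ _ (_ , onlyI) uv (inj₁ refl) = inj₂ (inj₂ (onlyI _ uv))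
  blockedCycle-inClosed _ (_ , onlyR) _ uv (inj₂ (inj₁ refl)) = inj₁ (onlyR _ uv)
  blockedCycle-inClosed (_ , onlyO) _ _ uv (inj₂ (inj₂ refl)) = inj₂ (inj₁ (onlyO _ uv))

  ∃-goodRoot : 3 < n → StronglyConnected T → ∃ GoodRoot
  ∃-goodRoot n>3 sc with ∃-king (fromℕ< (≤-trans (s≤s z≤n) n>3))
  ... | r , king with ∃-outside n>3 r r r
  ... | x , x∉r with ∃-outNeighbour sc (x∉r ∘ inj₁ ∘ sym)
  ... | _ , ro₀ with ∃-exitTriangle sc ro₀
  ... | _ , _ , exit , reached with goodRoot-or-blocked king exit reached
  ... | inj₁ good = r , good
  ... | inj₂ (o , i , blocked₁) with rotateBlocked sc blocked₁
  ... | inj₁ good = i , good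
  ... | inj₂ blocked₂ with rotateBlocked sc blocked₂
  ... | inj₁ good = o , good
  ... | inj₂ blocked₃ with ∃-outside n>3 r o i
  ... | y , y∉ = contradiction (inClosed⇒full sc (oneOf? r o i) (blockedCycle-inClosed blocked₁ blocked₂ blocked₃) (inj₁ refl) y) y∉

  strong⇒bkColorable : 3 < n → StronglyConnected T → BKColorable T
  strong⇒bkColorable n>3 sc =
    let _ , good = ∃-goodRoot n>3 sc in bibranching⇒bkColorable (proj₂ (goodRoot⇒bibranching good))

mainTheorem13 : (n : ℕ) → n ≥ 4 → (T : Tournament n) → BKColorable T ⇔ StronglyConnected T
mainTheorem13 n n≥4 T = mk⇔ (bkColorable⇒strong T) (strong⇒bkColorable T n≥4)
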